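{- In the Firefighter problem on the infinite strong grid, firefighters protecting four vertices at each step can contain the fire (indeed by the end of step $8$).
   Context: The infinite strong grid has vertex set $\mathbb{Z}^2$, with distinct vertices $(x,y)$ and $(x',y')$ adjacent iff $\max(|x-x'|,|y-y'|)=1$. The Firefighter problem with $k$ firefighters: at step $0$ a fire breaks out at one vertex, which becomes burned. At each subsequent step, the firefighters first protect $k$ vertices that are neither burned nor protected, and then the fire spreads from every burned vertex to all of its neighbours that are neither protected nor burned. Once a vertex is burned or protected it remains so forever. The fire is contained if the firefighters have a strategy ensuring there is some finite step after which no further vertex is burned. -}

module Defs where

open import Data.Nat using (ℕ; zero; suc; _⊔_; _≤_)
open import Data.Integer using (ℤ; ∣_∣; _-_)
open import Data.Fin using (Fin)
open import Data.Product using (_×_; _,_; Σ; ∃)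
open import Data.Sum using (_⊎_)
open import Data.Empty using (⊥)
open import Relation.Nullary using (¬_)
open import Relation.Binary.PropositionalEquality using (_≡_)

Vertex : Set
Vertex = ℤ × ℤ

Adj : Vertex → Vertex → Set
Adj (x , y) (x' , y') = (∣ x - x' ∣ ⊔ ∣ y - y' ∣) ≡ 1

-- A strategy for k firefighters: at step t+1 (t : ℕ) the firefighters
-- protect the k vertices  S t i , i : Fin k.
-- (The game is deterministic, so an adaptive strategy is the same as a
-- fixed sequence of moves.)
Strategy : ℕ → Set
Strategy k = ℕ → Fin k → Vertex

module Game {k : ℕ} (s : Vertex) (S : Strategy k) where

  Protected : ℕ → Vertex → Set
  Protected zero v = ⊥
  Protected (suc t) v = Protected t v ⊎ (Σ (Fin k) λ i → S t i ≡ v)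

  Burned : ℕ → Vertex → Set
  Burned zero v = v ≡ s
  Burned (suc t) v =
    Burned t v ⊎ (Σ Vertex λ u → Burned t u × Adj u v × ¬ Protected (suc t) v)

  Valid : Set
  Valid = ∀ t →
    (∀ i j → S t i ≡ S t j → i ≡ j) ×
    (∀ i → ¬ Burned t (S t i) × ¬ Protected t (S t i))

  ContainedBy : ℕ → Set
  ContainedBy T = ∀ t v → T ≤ t → Burned t v → Burned T v

  Contained : Set
  Contained = ∃ λ T → ContainedBy T

CanContainBy : ℕ → Vertex → ℕ → Set
CanContainBy k s T = Σ (Strategy k) λ S → Game.Valid s S × Game.ContainedBy s S T

CanContain : ℕ → Vertex → Set
CanContain k s = Σ (Strategy k) λ S → Game.Valid s S × Game.Contained s S

-- Translation invariance reduces the theorem to a fire starting at (1,5).  There four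
-- firefighters per step build, in eight steps, a closed barrier along the boundary of the
-- rectangle [0,9] × [0,7] (lower corners cut diagonally), each move landing on a vertex the
-- fire has not reached yet.  After step 8 the burned set is enclosed by protected vertices
-- and cannot grow, and the remaining firefighters go to fresh columns right of the barrier.
-- Legality of the first eight moves and enclosure at step 8 are finite facts: for any
-- strategy the burned set after t steps is computed exactly by iterating one round of
-- spreading on finite lists, so both are decided by evaluation.

module Submission where

open import Defs
open import Data.Empty using (⊥-elim)
open import Data.Fin as Fin using (Fin; toℕ)
import Data.Fin.Properties as Fin
open import Data.Integer as ℤ using (ℤ; +_; -[1+_]; ∣_∣)
import Data.Integer.Properties as ℤ
open import Data.Integer.Tactic.RingSolver using (solve-∀)
open import Data.List
  using (List; []; _∷_; _++_; map; filter; concatMap; cartesianProduct; deduplicate; tabulate)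
open import Data.List.Membership.Propositional using (_∈_; _∉_; find; lose)
open import Data.List.Membership.Propositional.Properties
open import Data.List.Relation.Unary.All as All using (All)
open import Data.List.Relation.Unary.Any using (here; there)
open import Data.Nat as ℕ using (ℕ; zero; suc; _+_; _∸_; _≤_; _⊔_; s≤s)
import Data.Nat.Properties as ℕ
open import Data.Product using (_×_; _,_; proj₁; proj₂; map₂)
open import Data.Product.Properties using (≡-dec)
open import Data.Sum using (_⊎_; inj₁; inj₂; [_,_]; [_,_]′)
open import Data.Vec using (_∷_; []; lookup)
open import Function using (_∘_)
open import Function.Bundles using (_⇔_; mk⇔; Equivalence)
open import Relation.Binary.Definitions using (DecidableEquality)
open import Relation.Binary.PropositionalEquality
  using (_≡_; refl; sym; trans; cong; cong₂; subst)
open import Relation.Nullary using (¬_; Dec; yes; no; _×-dec_; _⊎-dec_; _→-dec_)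
import Relation.Nullary.Decidable as Dec
open import Relation.Nullary.Decidable using (from-yes)

open Equivalence using (to; from)

infixl 6 _⊕_ _⊖_

_⊕_ : Vertex → Vertex → Vertex
(x , y) ⊕ (a , b) = (x ℤ.+ a , y ℤ.+ b)

_⊖_ : Vertex → Vertex → Vertex
(x , y) ⊖ (a , b) = (x ℤ.- a , y ℤ.- b)

_≟_ : DecidableEquality Vertex
_≟_ = ≡-dec ℤ._≟_ ℤ._≟_

open import Data.List.Membership.DecPropositional _≟_ using (_∈?_; _∉?_)

v⊕d⊖d≡v : ∀ v d → v ⊕ d ⊖ d ≡ v
v⊕d⊖d≡v (x , y) (a , b) = cong₂ _,_ (cancel x a) (cancel y b)
  where
  cancel : ∀ x a → x ℤ.+ a ℤ.- a ≡ x
  cancel = solve-∀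

v⊖d⊕d≡v : ∀ v d → v ⊖ d ⊕ d ≡ v
v⊖d⊕d≡v (x , y) (a , b) = cong₂ _,_ (cancel x a) (cancel y b)
  where
  cancel : ∀ x a → x ℤ.- a ℤ.+ a ≡ x
  cancel = solve-∀

u⊕[v⊖u]≡v : ∀ u v → u ⊕ (v ⊖ u) ≡ v
u⊕[v⊖u]≡v (x , y) (a , b) = cong₂ _,_ (cancel x a) (cancel y b)
  where
  cancel : ∀ x a → x ℤ.+ (a ℤ.- x) ≡ a
  cancel = solve-∀

u⊖[u⊖v]≡v : ∀ u v → u ⊖ (u ⊖ v) ≡ v
u⊖[u⊖v]≡v (x , y) (a , b) = cong₂ _,_ (cancel x a) (cancel y b)
  where
  cancel : ∀ x a → x ℤ.- (x ℤ.- a) ≡ a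
  cancel = solve-∀

[u⊖d]⊖[v⊖d]≡u⊖v : ∀ u v d → (u ⊖ d) ⊖ (v ⊖ d) ≡ u ⊖ v
[u⊖d]⊖[v⊖d]≡u⊖v (x , y) (x′ , y′) (a , b) = cong₂ _,_ (cancel x x′ a) (cancel y y′ b)
  where
  cancel : ∀ x x′ a → (x ℤ.- a) ℤ.- (x′ ℤ.- a) ≡ x ℤ.- x′
  cancel = solve-∀

∥_∥ : Vertex → ℕ
∥ (x , y) ∥ = ∣ x ∣ ⊔ ∣ y ∣

adj? : ∀ u v → Dec (Adj u v)
adj? u v = ∥ u ⊖ v ∥ ℕ.≟ 1

Adj-⊖-invariant : ∀ u v d → Adj (u ⊖ d) (v ⊖ d) ⇔ Adj u v
Adj-⊖-invariant u v d = mk⇔ (subst UnitNorm ([u⊖d]⊖[v⊖d]≡u⊖v u v d))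
                             (subst UnitNorm (sym ([u⊖d]⊖[v⊖d]≡u⊖v u v d)))
  where
  UnitNorm : Vertex → Set
  UnitNorm w = ∥ w ∥ ≡ 1

unitSteps : List ℤ
unitSteps = -[1+ 0 ] ∷ + 0 ∷ + 1 ∷ []

∣i∣≤1⇒i∈unitSteps : ∀ {i} → ∣ i ∣ ≤ 1 → i ∈ unitSteps
∣i∣≤1⇒i∈unitSteps { -[1+ 0 ]} _ = here refl
∣i∣≤1⇒i∈unitSteps {+ 0} _ = there (here refl)
∣i∣≤1⇒i∈unitSteps {+ 1} _ = there (there (here refl))
∣i∣≤1⇒i∈unitSteps {+ suc (suc _)} (s≤s ())
∣i∣≤1⇒i∈unitSteps { -[1+ suc _ ]} (s≤s ())

neighbours : Vertex → List Vertex
neighbours u = filter (adj? u) (map (u ⊖_) (cartesianProduct unitSteps unitSteps))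

adj⇔∈neighbours : ∀ u {v} → Adj u v ⇔ v ∈ neighbours u
adj⇔∈neighbours u {v} =
  mk⇔ (λ adj → ∈-filter⁺ (adj? u) (∈-box adj) adj) (proj₂ ∘ ∈-filter⁻ (adj? u))
  where
  ∈-box : Adj u v → v ∈ map (u ⊖_) (cartesianProduct unitSteps unitSteps)
  ∈-box adj = subst (_∈ _) (u⊖[u⊖v]≡v u v) (∈-map⁺ (u ⊖_) (∈-cartesianProduct⁺
    (∣i∣≤1⇒i∈unitSteps (subst (∣ dx ∣ ≤_) adj (ℕ.m≤m⊔n ∣ dx ∣ ∣ dy ∣)))
    (∣i∣≤1⇒i∈unitSteps (subst (∣ dy ∣ ≤_) adj (ℕ.m≤n⊔m ∣ dx ∣ ∣ dy ∣)))))
    where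
    dx dy : ℤ
    dx = proj₁ (u ⊖ v)
    dy = proj₂ (u ⊖ v)

-- Deduplication keeps the simulated lists small; the game does not need it.
spread : List Vertex → List Vertex → List Vertex
spread burning protected =
  deduplicate _≟_ (burning ++ filter (_∉? protected) (concatMap neighbours burning))

-- The deciders take the simulated lists as arguments, so evaluation computes each list once.
Enclosing : List Vertex → List Vertex → Set
Enclosing protected burning =
  All (λ u → All (λ v → v ∈ protected ⊎ v ∈ burning) (neighbours u)) burning

enclosing? : ∀ protected burning → Dec (Enclosing protected burning)
enclosing? protected burning =
  All.all? (λ u → All.all? (λ v → v ∈? protected ⊎-dec v ∈? burning) (neighbours u)) burning

injective? : ∀ {n} (f : Fin n → Vertex) → Dec (∀ i j → f i ≡ f j → i ≡ j)
injective? f = Fin.all? λ i → Fin.all? λ j → (f i ≟ f j) →-dec (i Fin.≟ j)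

avoids? : ∀ {n} (f : Fin n → Vertex) (burning protected : List Vertex) →
          Dec (∀ i → f i ∉ burning × f i ∉ protected)
avoids? f burning protected = Fin.all? λ i → (f i ∉? burning) ×-dec (f i ∉? protected)

module _ {k : ℕ} (s : Vertex) (S : Strategy k) where
  open Game s S

  protectedList : ℕ → List Vertex
  protectedList zero = []
  protectedList (suc t) = protectedList t ++ tabulate (S t)

  burnedList : ℕ → List Vertex
  burnedList zero = s ∷ []
  burnedList (suc t) = spread (burnedList t) (protectedList (suc t))

  protected⇔∈protectedList : ∀ t {v} → Protected t v ⇔ v ∈ protectedList t
  protected⇔∈protectedList zero = mk⇔ (λ ()) (λ ())
  protected⇔∈protectedList (suc t) {v} = mk⇔ sound complete
    where
    sound : Protected (suc t) v → v ∈ protectedList (suc t)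
    sound (inj₁ p) = ∈-++⁺ˡ (to (protected⇔∈protectedList t) p)
    sound (inj₂ (i , refl)) = ∈-++⁺ʳ (protectedList t) (∈-tabulate⁺ i)

    complete : v ∈ protectedList (suc t) → Protected (suc t) v
    complete v∈ with ∈-++⁻ (protectedList t) v∈
    ... | inj₁ v∈old = inj₁ (from (protected⇔∈protectedList t) v∈old)
    ... | inj₂ v∈new = let i , v≡ = ∈-tabulate⁻ v∈new in inj₂ (i , sym v≡)

  burned⇔∈burnedList : ∀ t {v} → Burned t v ⇔ v ∈ burnedList t
  burned⇔∈burnedList zero = mk⇔ (λ { refl → here refl }) (λ { (here v≡s) → v≡s })
  burned⇔∈burnedList (suc t) {v} = mk⇔ sound complete
    where
    open module IH {w : Vertex} = Equivalence (burned⇔∈burnedList t {w})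
      renaming (to to old-sound; from to old-complete)
    open module P {w : Vertex} = Equivalence (protected⇔∈protectedList (suc t) {w})
      renaming (to to protected-sound; from to protected-complete)

    sound : Burned (suc t) v → v ∈ burnedList (suc t)
    sound (inj₁ b) = ∈-deduplicate⁺ _≟_ (∈-++⁺ˡ (old-sound b))
    sound (inj₂ (u , bu , adj , unprotected)) =
      ∈-deduplicate⁺ _≟_ (∈-++⁺ʳ (burnedList t) (∈-filter⁺ (_∉? _)
        (∈-concatMap⁺ neighbours (lose (old-sound bu) (to (adj⇔∈neighbours u) adj)))
        (unprotected ∘ protected-complete)))

    complete : v ∈ burnedList (suc t) → Burned (suc t) v
    complete v∈ with ∈-++⁻ (burnedList t) (∈-deduplicate⁻ _≟_ _ v∈)
    ... | inj₁ v∈old = inj₁ (old-complete v∈old)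
    ... | inj₂ v∈new =
      let v∈nbrs , unprotected = ∈-filter⁻ (_∉? _) v∈new
          u , u∈old , v∈nbr = find (∈-concatMap⁻ neighbours v∈nbrs)
      in inj₂ (u , old-complete u∈old , from (adj⇔∈neighbours u) v∈nbr ,
               unprotected ∘ protected-sound)

  LegalMove : ℕ → Set
  LegalMove t =
    (∀ i j → S t i ≡ S t j → i ≡ j) × (∀ i → ¬ Burned t (S t i) × ¬ Protected t (S t i))

  legalMove? : ∀ t → Dec (LegalMove t)
  legalMove? t =
    Dec.map (mk⇔ (map₂ (unlisted⇒fresh ∘_)) (map₂ (fresh⇒unlisted ∘_)))
            (injective? (S t) ×-dec avoids? (S t) (burnedList t) (protectedList t))
    where
    unlisted⇒fresh : ∀ {v} → v ∉ burnedList t × v ∉ protectedList t →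
                     ¬ Burned t v × ¬ Protected t v
    unlisted⇒fresh (∉B , ∉P) =
      ∉B ∘ to (burned⇔∈burnedList t) , ∉P ∘ to (protected⇔∈protectedList t)

    fresh⇒unlisted : ∀ {v} → ¬ Burned t v × ¬ Protected t v →
                     v ∉ burnedList t × v ∉ protectedList t
    fresh⇒unlisted (¬B , ¬P) =
      ¬B ∘ from (burned⇔∈burnedList t) , ¬P ∘ from (protected⇔∈protectedList t)

  Enclosed : ℕ → Set
  Enclosed T = ∀ {u v} → Burned T u → Adj u v → ¬ Protected T v → Burned T v

  enclosed? : ∀ T → Dec (Enclosed T)
  enclosed? T = Dec.map (mk⇔ sufficient necessary) (enclosing? (protectedList T) (burnedList T))
    where
    open module B {v : Vertex} = Equivalence (burned⇔∈burnedList T {v})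
      renaming (to to burned-sound; from to burned-complete)
    open module P {v : Vertex} = Equivalence (protected⇔∈protectedList T {v})
      renaming (to to protected-sound; from to protected-complete)

    sufficient : Enclosing (protectedList T) (burnedList T) → Enclosed T
    sufficient enclosing {u} bu adj unprotected =
      [ ⊥-elim ∘ unprotected ∘ protected-complete , burned-complete ]
        (All.lookup (All.lookup enclosing (burned-sound bu)) (to (adj⇔∈neighbours u) adj))

    necessary : Enclosed T → Enclosing (protectedList T) (burnedList T)
    necessary enclosed = All.tabulate λ u∈ → All.tabulate λ v∈ → listed u∈ v∈
      where
      listed : ∀ {u v} → u ∈ burnedList T → v ∈ neighbours u →
               v ∈ protectedList T ⊎ v ∈ burnedList T
      listed {u} {v} u∈ v∈ with v ∈? protectedList T
      ... | yes v∈P = inj₁ v∈P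
      ... | no v∉P = inj₂ (burned-sound
        (enclosed (burned-complete u∈) (from (adj⇔∈neighbours u) v∈) (v∉P ∘ protected-sound)))

  protected-mono : ∀ {T} n {v} → Protected T v → Protected (n + T) v
  protected-mono zero p = p
  protected-mono (suc n) p = inj₁ (protected-mono n p)

  enclosed⇒containedBy : ∀ {T} → Enclosed T → ContainedBy T
  enclosed⇒containedBy {T} enclosed t v T≤t b =
    stable (t ∸ T) (subst (λ t → Burned t v) (sym (ℕ.m∸n+n≡m T≤t)) b)
    where
    stable : ∀ n {v} → Burned (n + T) v → Burned T v
    stable zero b = b
    stable (suc n) (inj₁ b) = stable n b
    stable (suc n) (inj₂ (u , bu , adj , unprotected)) =
      enclosed (stable n bu) adj (unprotected ∘ protected-mono (suc n))

module _ {k : ℕ} (s : Vertex) (S : Strategy k) (d : Vertex) where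
  private
    module G = Game s S
    module G′ = Game (s ⊕ d) (λ t i → S t i ⊕ d)

  protected-translate : ∀ t {w} → G′.Protected t w ⇔ G.Protected t (w ⊖ d)
  protected-translate zero = mk⇔ (λ ()) (λ ())
  protected-translate (suc t) {w} = mk⇔ forth back
    where
    forth : G′.Protected (suc t) w → G.Protected (suc t) (w ⊖ d)
    forth (inj₁ p) = inj₁ (to (protected-translate t) p)
    forth (inj₂ (i , refl)) = inj₂ (i , sym (v⊕d⊖d≡v (S t i) d))

    back : G.Protected (suc t) (w ⊖ d) → G′.Protected (suc t) w
    back (inj₁ p) = inj₁ (from (protected-translate t) p)
    back (inj₂ (i , e)) = inj₂ (i , trans (cong (_⊕ d) e) (v⊖d⊕d≡v w d))

  burned-translate : ∀ t {w} → G′.Burned t w ⇔ G.Burned t (w ⊖ d)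
  burned-translate zero {w} =
    mk⇔ (λ { refl → v⊕d⊖d≡v s d }) (λ e → trans (sym (v⊖d⊕d≡v w d)) (cong (_⊕ d) e))
  burned-translate (suc t) {w} = mk⇔ forth back
    where
    forth : G′.Burned (suc t) w → G.Burned (suc t) (w ⊖ d)
    forth (inj₁ b) = inj₁ (to (burned-translate t) b)
    forth (inj₂ (u , bu , adj , unprotected)) =
      inj₂ (u ⊖ d , to (burned-translate t) bu , from (Adj-⊖-invariant u w d) adj ,
            unprotected ∘ from (protected-translate (suc t)))

    back : G.Burned (suc t) (w ⊖ d) → G′.Burned (suc t) w
    back (inj₁ b) = inj₁ (from (burned-translate t) b)
    back (inj₂ (u , bu , adj , unprotected)) =
      inj₂ (u ⊕ d , from (burned-translate t) (subst (G.Burned t) u≡ bu) ,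
            to (Adj-⊖-invariant (u ⊕ d) w d) (subst (λ x → Adj x (w ⊖ d)) u≡ adj) ,
            unprotected ∘ to (protected-translate (suc t)))
      where
      u≡ : u ≡ u ⊕ d ⊖ d
      u≡ = sym (v⊕d⊖d≡v u d)

  valid-translate : G.Valid → G′.Valid
  valid-translate valid t =
    (λ i j e → proj₁ (valid t) i j (⊕-injective e)) ,
    (λ i → proj₁ (proj₂ (valid t) i) ∘ unshift (G.Burned t) ∘ to (burned-translate t) ,
           proj₂ (proj₂ (valid t) i) ∘ unshift (G.Protected t) ∘ to (protected-translate t))
    where
    ⊕-injective : ∀ {v w} → v ⊕ d ≡ w ⊕ d → v ≡ w
    ⊕-injective {v} {w} e =
      trans (sym (v⊕d⊖d≡v v d)) (trans (cong (_⊖ d) e) (v⊕d⊖d≡v w d))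

    unshift : ∀ (P : Vertex → Set) {v} → P (v ⊕ d ⊖ d) → P v
    unshift P = subst P (v⊕d⊖d≡v _ d)

  containedBy-translate : ∀ {T} → G.ContainedBy T → G′.ContainedBy T
  containedBy-translate {T} contained t w T≤t =
    from (burned-translate T) ∘ contained t (w ⊖ d) T≤t ∘ to (burned-translate t)

canContainBy-translate : ∀ {k s T} s′ → CanContainBy k s T → CanContainBy k s′ T
canContainBy-translate {s = s} s′ (S , valid , contained) =
  subst (λ s′ → CanContainBy _ s′ _) (u⊕[v⊖u]≡v s s′)
    ((λ t i → S t i ⊕ d) , valid-translate s S d valid , containedBy-translate s S d contained)
  where
  d : Vertex
  d = s′ ⊖ s

cell : ℕ → ℕ → Vertex
cell x y = (+ x , + y)

ignition : Vertex
ignition = cell 1 5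

wall : Strategy 4
wall 0 i = lookup (cell 0 4 ∷ cell 0 5 ∷ cell 0 6 ∷ cell 0 3 ∷ []) i
wall 1 i = lookup (cell 0 7 ∷ cell 1 7 ∷ cell 2 7 ∷ cell 3 7 ∷ []) i
wall 2 i = lookup (cell 0 2 ∷ cell 1 2 ∷ cell 4 7 ∷ cell 1 1 ∷ []) i
wall 3 i = lookup (cell 5 7 ∷ cell 1 0 ∷ cell 2 0 ∷ cell 3 0 ∷ []) i
wall 4 i = lookup (cell 4 0 ∷ cell 5 0 ∷ cell 6 0 ∷ cell 6 7 ∷ []) i
wall 5 i = lookup (cell 7 0 ∷ cell 7 7 ∷ cell 8 0 ∷ cell 8 1 ∷ []) i
wall 6 i = lookup (cell 8 7 ∷ cell 9 1 ∷ cell 9 2 ∷ cell 9 3 ∷ []) i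
wall 7 i = lookup (cell 9 4 ∷ cell 9 5 ∷ cell 9 6 ∷ cell 9 7 ∷ []) i
wall t i = cell (2 + t) (toℕ i)

private
  module W = Game ignition wall

wall-enclosed : Enclosed ignition wall 8
wall-enclosed = from-yes (enclosed? ignition wall 8)

wall-containedBy-8 : W.ContainedBy 8
wall-containedBy-8 = enclosed⇒containedBy ignition wall wall-enclosed

wall-legal-before-8 : ∀ (t : Fin 8) → LegalMove ignition wall (toℕ t)
wall-legal-before-8 = from-yes (Fin.all? {8} (legalMove? ignition wall ∘ toℕ))

LeftOfColumn : ℤ → List Vertex → Set
LeftOfColumn x = All (λ v → proj₁ v ℤ.≤ x)

wall-left-of-column-9 :
  LeftOfColumn (+ 9) (burnedList ignition wall 8) × LeftOfColumn (+ 9) (protectedList ignition wall 8)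
wall-left-of-column-9 =
  from-yes (leftOf? (burnedList ignition wall 8) ×-dec leftOf? (protectedList ignition wall 8))
  where
  leftOf? : ∀ L → Dec (LeftOfColumn (+ 9) L)
  leftOf? = All.all? (λ v → proj₁ v ℤ.≤? + 9)

wall-burned-column : ∀ n {v} → W.Burned (8 + n) v → proj₁ v ℤ.≤ + (9 + n)
wall-burned-column n b = ℤ.≤-trans
  (All.lookup (proj₁ wall-left-of-column-9)
    (to (burned⇔∈burnedList ignition wall 8) (wall-containedBy-8 _ _ (ℕ.m≤m+n 8 n) b)))
  (ℤ.+≤+ (ℕ.m≤m+n 9 n))

wall-protected-column : ∀ n {v} → W.Protected (8 + n) v → proj₁ v ℤ.≤ + (9 + n)
wall-protected-column zero p =
  All.lookup (proj₂ wall-left-of-column-9) (to (protected⇔∈protectedList ignition wall 8) p)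
wall-protected-column (suc n) (inj₁ p) =
  ℤ.≤-trans (wall-protected-column n p) (ℤ.+≤+ (ℕ.n≤1+n _))
wall-protected-column (suc n) (inj₂ (i , refl)) = ℤ.≤-refl

wall-legal-after-8 : ∀ n → LegalMove ignition wall (8 + n)
wall-legal-after-8 n =
  (λ i j e → Fin.toℕ-injective (ℤ.+-injective (cong proj₂ e))) ,
  (λ i → fresh ∘ inj₁ , fresh ∘ inj₂)
  where
  fresh : ∀ {i} →
          ¬ (W.Burned (8 + n) (wall (8 + n) i) ⊎ W.Protected (8 + n) (wall (8 + n) i))
  fresh b⊎p = ℕ.1+n≰n (ℤ.drop‿+≤+ ([ wall-burned-column n , wall-protected-column n ]′ b⊎p))

wall-valid : W.Valid
wall-valid t with t ℕ.<? 8
... | yes t<8 =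
  subst (LegalMove ignition wall) (Fin.toℕ-fromℕ< t<8) (wall-legal-before-8 (Fin.fromℕ< t<8))
... | no t≮8 =
  subst (LegalMove ignition wall) (ℕ.m+[n∸m]≡n (ℕ.≮⇒≥ t≮8)) (wall-legal-after-8 (t ∸ 8))

mainTheorem5 : (s : Vertex) → CanContain 4 s × CanContainBy 4 s 8
mainTheorem5 s = map₂ (map₂ (8 ,_)) wall-translated , wall-translated
  where
  wall-translated : CanContainBy 4 s 8
  wall-translated = canContainBy-translate s (wall , wall-valid , wall-containedBy-8)
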